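{- For any integers $n\ge 4$, $m\ge 2$ and $k\in\{2,\ldots,n-2\}$, writing $\eta=\lfloor n/(k+2)\rfloor$, $$\chi_{\mu_k}(P_n\boxtimes K_m)=\begin{cases}2\eta & \text{if } n\equiv 0 \pmod{k+2},\\ 2\eta+1 & \text{if } n\equiv 1,2 \pmod{k+2},\\ 2\eta+2 & \text{otherwise.}\end{cases}$$
   Context: All graphs are finite, simple and undirected; $P_n$ is the path on $n$ vertices and $K_m$ the complete graph on $m$ vertices. The strong product $G\boxtimes H$ has vertex set $V(G)\times V(H)$, with distinct $(g,h),(g',h')$ adjacent iff ($g=g'$ or $gg'\in E(G)$) and ($h=h'$ or $hh'\in E(H)$). A $u,v$-geodesic is a shortest $u,v$-path. For a positive integer $k$, a set $M\subseteq V(X)$ is a $k$-distance mutual-visibility set of $X$ if for every two distinct $u,v\in M$ there is a $u,v$-geodesic of length at most $k$ none of whose internal vertices lies in $M$; $\chi_{\mu_k}(X)$ is the minimum number of parts in a partition of $V(X)$ into such sets. -}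

module Defs where

open import Level using (0ℓ)
open import Data.Nat using (ℕ; zero; suc; _+_; _*_; _<_; _≤_)
open import Data.Nat.DivMod using (_/_; _%_)
open import Data.Fin using (Fin; toℕ; fromℕ; inject₁)
open import Data.Product using (Σ; ∃; _×_; _,_)
open import Data.Sum using (_⊎_)
open import Relation.Binary.PropositionalEquality using (_≡_; _≢_)
open import Relation.Nullary using (¬_)

record Graph : Set₁ where
  field
    V   : Set
    Adj : V → V → Set

open Graph public

Path : ℕ → Graph
Path n = record { V = Fin n ; Adj = λ i j → (toℕ j ≡ suc (toℕ i)) ⊎ (toℕ i ≡ suc (toℕ j)) }

Complete : ℕ → Graph
Complete m = record { V = Fin m ; Adj = λ i j → i ≢ j }

_⊠_ : Graph → Graph → Graph
G ⊠ H = record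
  { V = V G × V H
  ; Adj = λ { (g , h) (g' , h') →
        ((g , h) ≢ (g' , h'))
      × ((g ≡ g') ⊎ Adj G g g')
      × ((h ≡ h') ⊎ Adj H h h') }
  }

IsWalk : (G : Graph) → (u v : V G) → (ℓ : ℕ) → (Fin (suc ℓ) → V G) → Set
IsWalk G u v ℓ w =
    (w Fin.zero ≡ u)
  × (w (fromℕ ℓ) ≡ v)
  × (∀ (i : Fin ℓ) → Adj G (w (inject₁ i)) (w (Fin.suc i)))
  where import Data.Fin as Fin

IsGeodesic : (G : Graph) → (u v : V G) → (ℓ : ℕ) → (Fin (suc ℓ) → V G) → Set
IsGeodesic G u v ℓ w =
    IsWalk G u v ℓ w
  × (∀ ℓ' → ℓ' < ℓ → ¬ (Σ (Fin (suc ℓ') → V G) (IsWalk G u v ℓ')))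

IsKDistMV : (G : Graph) → ℕ → (V G → Set) → Set
IsKDistMV G k M =
  ∀ u v → M u → M v → u ≢ v →
    Σ ℕ λ ℓ → (ℓ ≤ k) × Σ (Fin (suc ℓ) → V G) λ w →
      IsGeodesic G u v ℓ w
      × (∀ (i : Fin (suc ℓ)) → i ≢ Fin.zero → i ≢ fromℕ ℓ → ¬ M (w i))
  where import Data.Fin as Fin

-- A partition of V(G) into at most p k-distance mutual-visibility sets,
-- encoded as a colouring c : V G → Fin p whose colour classes are such sets.
KDistMVColouring : (G : Graph) → ℕ → ℕ → Set
KDistMVColouring G k p =
  Σ (V G → Fin p) λ c → ∀ (i : Fin p) → IsKDistMV G k (λ x → c x ≡ i)

ChiMuK≡ : (G : Graph) → ℕ → ℕ → Set
ChiMuK≡ G k p = KDistMVColouring G k p × (∀ q → q < p → ¬ KDistMVColouring G k q)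

chiCase : ℕ → ℕ → ℕ
chiCase η 0 = 2 * η
chiCase η 1 = 2 * η + 1
chiCase η 2 = 2 * η + 1
chiCase η (suc (suc (suc _))) = 2 * η + 2

chiValue : ℕ → ℕ → ℕ
chiValue n k = chiCase (n / (2 + k)) (n % (2 + k))

-- Column indices are 1-Lipschitz along walks of P_n ⊠ K_m. Hence two vertices of one colour
-- class of a k-distance mutual-visibility colouring lie at most k columns apart, and every column
-- strictly between them contains a vertex of another colour; conversely these two conditions
-- suffice, since a geodesic can climb column by column through vertices of other colours.
--
-- Upper bound: cut the columns into blocks of k + 2. Block t gets colour 2t + 1 on its offset
-- k + 1 and on the rows ≥ 1 of its offsets 1, …, k - 1 except in the last column of the graph,
-- and colour 2t elsewhere; in particular a last block of one or two columns is monochromatic.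
--
-- Lower bound: let S x be the number of colours used on the columns ≥ x. If column x + 1 has the
-- colour of (x, 0) throughout, that colour does not reach column x + 2, so S x ≥ 1 + S (x + 2);
-- otherwise columns x and x + 1 carry two colours that do not reach column x + k + 2, so
-- S x ≥ 2 + S (x + k + 2). The stated value is the least solution of this recurrence.

module Submission where

open import Defs
open import Data.Bool using (Bool; true; false)
open import Data.Empty using (⊥-elim)
open import Data.Fin as Fin using (Fin; toℕ; fromℕ; fromℕ<; inject₁; opposite)
open import Data.Fin.Properties
  using (opposite-involutive; toℕ-injective; toℕ-fromℕ<; toℕ<n; any?; all?; ¬∀⟶∃¬)
open import Data.Fin.Subset using (Subset; _∈_; _∉_; _⊆_; ∣_∣) renaming (_-_ to _-ₛ_)
open import Data.Fin.Subset.Properties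
  using (p⊂q⇒∣p∣<∣q∣; x∈p∧x≢y⇒x∈p-y; x∈p⇒∣p-x∣<∣p∣; ∣p∣≤n)
open import Data.Nat
  using (ℕ; zero; suc; _+_; _*_; _∸_; _<_; _≤_; z≤n; s≤s; s≤s⁻¹; ∣_-_∣; _≟_; _<?_; _≤?_; NonZero)
open import Data.Nat.DivMod
open import Data.Nat.Induction using (<-rec)
open import Data.Nat.Properties
open import Data.Product using (Σ; ∃; _×_; _,_; proj₁; proj₂)
open import Data.Product.Properties using (≡-dec)
open import Data.Sum as Sum using (_⊎_; inj₁; inj₂)
import Data.Vec as Vec
open import Data.Vec.Functional using (_∷_; tail; reverse)
open import Data.Vec.Properties using (lookup∘tabulate; lookup⇒[]=; []=⇒lookup)
open import Function using (_∘_; case_of_)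
open import Relation.Binary using (Symmetric; tri<; tri≈; tri>)
open import Relation.Binary.PropositionalEquality
open import Relation.Nullary using (¬_; yes; no)
open import Relation.Nullary.Decidable
  using (Dec; toSum; dec-true; dec-false; does; _×-dec_; _⊎-dec_)
open import Relation.Unary using (Decidable)

∣m-n∣≤k⇒n≤m+k : ∀ {m n k} → ∣ m - n ∣ ≤ k → n ≤ m + k
∣m-n∣≤k⇒n≤m+k {m} {n} ∣m-n∣≤k = ≤-trans (m≤n+∣n-m∣ n m) (+-monoʳ-≤ m ∣m-n∣≤k)

m≤n⇒∃[o]o+m≡n : ∀ {m n} → m ≤ n → ∃ λ o → o + m ≡ n
m≤n⇒∃[o]o+m≡n {m} {n} m≤n = n ∸ m , m∸n+n≡m m≤n

∣n-suc-n∣≡1 : ∀ n → ∣ n - suc n ∣ ≡ 1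
∣n-suc-n∣≡1 zero    = refl
∣n-suc-n∣≡1 (suc n) = ∣n-suc-n∣≡1 n

∣m-n∣≤k-window : ∀ {s a b k} → s ≤ a → b ≤ s + k → a ≤ b → ∣ a - b ∣ ≤ k
∣m-n∣≤k-window {s} {a} {b} {k} s≤a b≤s+k a≤b = begin
  ∣ a - b ∣ ≡⟨ m≤n⇒∣m-n∣≡n∸m a≤b ⟩
  b ∸ a     ≤⟨ ∸-mono b≤s+k s≤a ⟩
  s + k ∸ s ≡⟨ m+n∸m≡n s k ⟩
  k         ∎
  where open ≤-Reasoning

opposite-fromℕ : ∀ ℓ → opposite (fromℕ ℓ) ≡ Fin.zero
opposite-fromℕ zero    = refl
opposite-fromℕ (suc ℓ) = cong inject₁ (opposite-fromℕ ℓ)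

opposite-inject₁ : ∀ {ℓ} (i : Fin ℓ) → opposite (inject₁ i) ≡ Fin.suc (opposite i)
opposite-inject₁ Fin.zero    = refl
opposite-inject₁ (Fin.suc i) = cong inject₁ (opposite-inject₁ i)

module Walks (G : Graph) where

  InteriorAvoids : ∀ {ℓ} → (V G → Set) → (Fin (suc ℓ) → V G) → Set
  InteriorAvoids {ℓ} M w = ∀ i → i ≢ Fin.zero → i ≢ fromℕ ℓ → ¬ M (w i)

  Visible : ℕ → (V G → Set) → V G → V G → Set
  Visible k M u v = Σ ℕ λ ℓ → (ℓ ≤ k) × Σ (Fin (suc ℓ) → V G) λ w →
    IsGeodesic G u v ℓ w × InteriorAvoids M w

  ∷-isWalk : ∀ {u u' v ℓ} w → Adj G u u' → IsWalk G u' v ℓ w → IsWalk G u v (suc ℓ) (u ∷ w)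
  ∷-isWalk w u~u' (refl , end , steps) =
    refl , end , λ { Fin.zero → u~u' ; (Fin.suc i) → steps i }

  tail-isWalk : ∀ {u v ℓ} w → IsWalk G u v (suc ℓ) w →
    Adj G u (w (Fin.suc Fin.zero)) × IsWalk G (w (Fin.suc Fin.zero)) v ℓ (tail w)
  tail-isWalk w (refl , end , steps) = steps Fin.zero , refl , end , steps ∘ Fin.suc

  isWalk₀⇒≡ : ∀ {u v} w → IsWalk G u v 0 w → u ≡ v
  isWalk₀⇒≡ w (start , end , _) = trans (sym start) end

  edge-isWalk : ∀ {u v} → Adj G u v → IsWalk G u v 1 (u ∷ λ _ → v)
  edge-isWalk u~v = ∷-isWalk (λ _ → _) u~v (refl , refl , λ ())

  edge-isGeodesic : ∀ {u v} → u ≢ v → Adj G u v → IsGeodesic G u v 1 (u ∷ λ _ → v)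
  edge-isGeodesic u≢v u~v =
    edge-isWalk u~v , λ { zero _ (w , walk) → u≢v (isWalk₀⇒≡ w walk) ; (suc _) (s≤s ()) }

  edge-interiorAvoids : ∀ {M u v} → InteriorAvoids {1} M (u ∷ λ _ → v)
  edge-interiorAvoids Fin.zero 0≢0 _ = ⊥-elim (0≢0 refl)
  edge-interiorAvoids (Fin.suc Fin.zero) _ 1≢1 = ⊥-elim (1≢1 refl)

  module _ (adj-sym : Symmetric (Adj G)) where

    reverse-isWalk : ∀ {u v ℓ} w → IsWalk G u v ℓ w → IsWalk G v u ℓ (reverse w)
    reverse-isWalk {ℓ = ℓ} w (start , end , steps) =
      end , trans (cong w (opposite-fromℕ ℓ)) start , step
      where
      step : ∀ i → Adj G (w (opposite (inject₁ i))) (w (opposite (Fin.suc i)))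
      step i rewrite opposite-inject₁ i = adj-sym (steps (opposite i))

    reverse-isGeodesic : ∀ {u v ℓ} w → IsGeodesic G u v ℓ w → IsGeodesic G v u ℓ (reverse w)
    reverse-isGeodesic w (walk , shortest) =
      reverse-isWalk w walk ,
      λ ℓ' ℓ'<ℓ (w' , walk') → shortest ℓ' ℓ'<ℓ (reverse w' , reverse-isWalk w' walk')

    reverse-interiorAvoids : ∀ {M ℓ} (w : Fin (suc ℓ) → V G) →
      InteriorAvoids M w → InteriorAvoids M (reverse w)
    reverse-interiorAvoids {ℓ = ℓ} w avoids i i≢0 i≢ℓ = avoids (opposite i) (i≢ℓ ∘ from) (i≢0 ∘ to)
      where
      from : opposite i ≡ Fin.zero → i ≡ fromℕ ℓ
      from e = trans (sym (opposite-involutive i)) (cong opposite e)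
      to : opposite i ≡ fromℕ ℓ → i ≡ Fin.zero
      to e = trans (sym (opposite-involutive i)) (trans (cong opposite e) (opposite-fromℕ ℓ))

    visible-sym : ∀ {k M u v} → Visible k M u v → Visible k M v u
    visible-sym {M = M} (ℓ , ℓ≤k , w , geodesic , avoids) =
      ℓ , ℓ≤k , reverse w , reverse-isGeodesic w geodesic , reverse-interiorAvoids {M} w avoids

1-Lipschitz : (G : Graph) → (V G → ℕ) → Set
1-Lipschitz G h = ∀ {u v} → Adj G u v → ∣ h u - h v ∣ ≤ 1

module Levels (G : Graph) (h : V G → ℕ) (h-lipschitz : 1-Lipschitz G h) where

  open Walks G

  1-Lipschitz⇒≤suc : ∀ {u v} → Adj G u v → h v ≤ suc (h u)
  1-Lipschitz⇒≤suc {u} {v} u~v = subst (h v ≤_) (+-comm (h u) 1) (∣m-n∣≤k⇒n≤m+k (h-lipschitz {u} {v} u~v))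

  isWalk-lipschitz : ∀ {u v ℓ} w → IsWalk G u v ℓ w → ∣ h u - h v ∣ ≤ ℓ
  isWalk-lipschitz {u} {ℓ = zero} w walk with isWalk₀⇒≡ w walk
  ... | refl = ≤-reflexive (∣n-n∣≡0 (h u))
  isWalk-lipschitz {u} {v} {suc ℓ} w walk with tail-isWalk w walk
  ... | u~w₁ , walk₁ =
    ≤-trans (∣-∣-triangle (h u) (h (w (Fin.suc Fin.zero))) (h v))
            (+-mono-≤ (h-lipschitz u~w₁) (isWalk-lipschitz (tail w) walk₁))

  isWalk-crosses : ∀ {u v ℓ y} w → IsWalk G u v ℓ w → h u ≤ y → y ≤ h v → ∃ λ i → h (w i) ≡ y
  isWalk-crosses {ℓ = zero} w walk@(start , _) hu≤y y≤hv with isWalk₀⇒≡ w walk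
  ... | refl = Fin.zero , trans (cong h start) (≤-antisym hu≤y y≤hv)
  isWalk-crosses {u} {ℓ = suc ℓ} {y} w walk@(start , _) hu≤y y≤hv with h u ≟ y | tail-isWalk w walk
  ... | yes hu≡y | _ = Fin.zero , trans (cong h start) hu≡y
  ... | no hu≢y | u~w₁ , walk₁ =
    let w₁≤y = ≤-trans (1-Lipschitz⇒≤suc u~w₁) (≤∧≢⇒< hu≤y hu≢y)
        (i , e) = isWalk-crosses (tail w) walk₁ w₁≤y y≤hv
    in Fin.suc i , e

  isWalk-tight⇒isGeodesic : ∀ {u v ℓ} w → IsWalk G u v ℓ w → ℓ ≤ ∣ h u - h v ∣ →
    IsGeodesic G u v ℓ w
  isWalk-tight⇒isGeodesic w walk tight =
    walk , λ ℓ' ℓ'<ℓ (w' , walk') → <⇒≱ ℓ'<ℓ (≤-trans tight (isWalk-lipschitz w' walk'))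

  module _ {k : ℕ} {M : V G → Set} where

    visible-close : ∀ {u v} → Visible k M u v → ∣ h u - h v ∣ ≤ k
    visible-close (ℓ , ℓ≤k , w , (walk , _) , _) = ≤-trans (isWalk-lipschitz w walk) ℓ≤k

    visible-crosses : ∀ {u v y} → Visible k M u v → h u < y → y < h v →
      ∃ λ x → h x ≡ y × ¬ M x
    visible-crosses (ℓ , _ , w , (walk@(start , end , _) , _) , avoids) hu<y y<hv =
      w i , hwi≡y , avoids i i≢0 i≢ℓ
      where
      crossing = isWalk-crosses w walk (<⇒≤ hu<y) (<⇒≤ y<hv)
      i = proj₁ crossing
      hwi≡y = proj₂ crossing
      i≢0 : i ≢ Fin.zero
      i≢0 i≡0 = <⇒≢ hu<y (trans (cong h (trans (sym start) (cong w (sym i≡0)))) hwi≡y)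
      i≢ℓ : i ≢ fromℕ ℓ
      i≢ℓ i≡ℓ = <⇒≢ y<hv (trans (sym hwi≡y) (cong h (trans (cong w i≡ℓ) end)))

module _ {q : ℕ} {P : Fin q → Set} (P? : Decidable P) where

  subsetOf : Subset q
  subsetOf = Vec.tabulate (does ∘ P?)

  ∈-subsetOf⁺ : ∀ {i} → P i → i ∈ subsetOf
  ∈-subsetOf⁺ {i} Pi =
    lookup⇒[]= i subsetOf (trans (lookup∘tabulate (does ∘ P?) i) (dec-true (P? i) Pi))

  ∈-subsetOf⁻ : ∀ {i} → i ∈ subsetOf → P i
  ∈-subsetOf⁻ {i} i∈ with P? i | trans (sym (lookup∘tabulate (does ∘ P?) i)) ([]=⇒lookup i∈)
  ... | yes Pi | _  = Pi
  ... | no _   | ()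

2+∣p∣≤∣q∣ : ∀ {n} {p q : Subset n} {x y} → p ⊆ q → x ∈ q → y ∈ q → x ≢ y → x ∉ p → y ∉ p →
            2 + ∣ p ∣ ≤ ∣ q ∣
2+∣p∣≤∣q∣ {p = p} {q} {x} p⊆q x∈q y∈q x≢y x∉p y∉p =
  ≤-trans (s≤s (p⊂q⇒∣p∣<∣q∣ (p⊆q-x , _ , x∈p∧x≢y⇒x∈p-y y∈q (x≢y ∘ sym) , y∉p))) (x∈p⇒∣p-x∣<∣p∣ x∈q)
  where
  p⊆q-x : p ⊆ q -ₛ x
  p⊆q-x {i} i∈p = x∈p∧x≢y⇒x∈p-y (p⊆q i∈p) (λ i≡x → x∉p (subst (_∈ p) i≡x i∈p))

module PathStrongComplete (n m : ℕ) where

  G : Graph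
  G = Path n ⊠ Complete m

  col : V G → ℕ
  col (g , _) = toℕ g

  col-1-Lipschitz : 1-Lipschitz G col
  col-1-Lipschitz {g , _} {g' , _} (_ , inj₁ refl , _) = ≤-trans (≤-reflexive (∣n-n∣≡0 (toℕ g))) z≤n
  col-1-Lipschitz {g , _} {g' , _} (_ , inj₂ (inj₁ up) , _) =
    ≤-reflexive (trans (cong (λ x → ∣ toℕ g - x ∣) up) (∣n-suc-n∣≡1 (toℕ g)))
  col-1-Lipschitz {g , _} {g' , _} (_ , inj₂ (inj₂ down) , _) =
    ≤-reflexive (trans (cong (λ x → ∣ x - toℕ g' ∣) down)
                       (trans (∣-∣-comm _ (toℕ g')) (∣n-suc-n∣≡1 (toℕ g'))))

  adj-sym : Symmetric (Adj G)
  adj-sym (u≢v , columns , rows) =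
    u≢v ∘ sym , Sum.map sym Sum.swap columns , Sum.map sym (_∘ sym) rows

  adj-step : ∀ {u v} → col v ≡ suc (col u) → Adj G u v
  adj-step {g , h} {g' , h'} up =
    (λ u≡v → 1+n≢n (trans (sym up) (cong col (sym u≡v)))) , inj₂ (inj₁ up) , toSum (h Fin.≟ h')

  adj-same-column : ∀ {u v} → col u ≡ col v → u ≢ v → Adj G u v
  adj-same-column {g , h} {g' , h'} same u≢v =
    u≢v , inj₁ (toℕ-injective same) , toSum (h Fin.≟ h')

  open Walks G
  open Levels G col col-1-Lipschitz

  module _ {M : V G → Set} where

    Gaps : V G → V G → Set
    Gaps u v = ∀ g → col u < toℕ g → toℕ g < col v → ∃ λ h → ¬ M (g , h)

    ascending-walk : ∀ d u v → col v ≡ suc d + col u → Gaps u v →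
      Σ (Fin (2 + d) → V G) λ w → IsWalk G u v (suc d) w × InteriorAvoids M w
    ascending-walk zero u v up _ =
      u ∷ (λ _ → v) , edge-isWalk (adj-step up) , edge-interiorAvoids {M}
    ascending-walk (suc d) u@(g , _) v up gaps =
      u ∷ w₁ , ∷-isWalk w₁ (adj-step (toℕ-fromℕ< g₁<n)) walk₁ , avoids
      where
      g₁<v : suc (toℕ g) < col v
      g₁<v = ≤-trans (s≤s (s≤s (m≤n+m (toℕ g) d))) (≤-reflexive (sym up))
      g₁<n : suc (toℕ g) < n
      g₁<n = <-trans g₁<v (toℕ<n (proj₁ v))
      g₁ = fromℕ< g₁<n
      u<g₁ : col u < toℕ g₁
      u<g₁ = ≤-reflexive (sym (toℕ-fromℕ< g₁<n))
      outside₁ = gaps g₁ u<g₁ (subst (_< col v) (sym (toℕ-fromℕ< g₁<n)) g₁<v)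
      u₁ : V G
      u₁ = g₁ , proj₁ outside₁
      rest = ascending-walk d u₁ v
        (trans up (trans (sym (+-suc (suc d) (toℕ g))) (cong (suc d +_) (sym (toℕ-fromℕ< g₁<n)))))
        (λ g' g₁<g' g'<v → gaps g' (<-trans u<g₁ g₁<g') g'<v)
      w₁ = proj₁ rest
      walk₁ = proj₁ (proj₂ rest)
      avoids : InteriorAvoids M (u ∷ w₁)
      avoids Fin.zero 0≢0 _ = ⊥-elim (0≢0 refl)
      avoids (Fin.suc Fin.zero) _ _ = subst (¬_ ∘ M) (sym (proj₁ walk₁)) (proj₂ outside₁)
      avoids (Fin.suc (Fin.suc i)) _ i≢ℓ = proj₂ (proj₂ rest) (Fin.suc i) (λ ()) (i≢ℓ ∘ cong Fin.suc)

    ascending-visible : ∀ {k u v} → col u < col v → col v ≤ col u + k → Gaps u v → Visible k M u v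
    ascending-visible {k} {u} {v} u<v v≤u+k gaps =
      suc d , gap≤ v≤u+k , w , isWalk-tight⇒isGeodesic w walk (gap≤ (m≤n+∣n-m∣ (col v) (col u))) , avoids
      where
      d = col v ∸ suc (col u)
      up : col v ≡ suc d + col u
      up = trans (sym (m∸n+n≡m u<v)) (+-suc d (col u))
      gap≤ : ∀ {x} → col v ≤ col u + x → suc d ≤ x
      gap≤ {x} v≤u+x = +-cancelʳ-≤ (col u) (suc d) x
        (≤-trans (≤-reflexive (sym up)) (≤-trans v≤u+x (≤-reflexive (+-comm (col u) x))))
      climb = ascending-walk d u v up gaps
      w = proj₁ climb
      walk = proj₁ (proj₂ climb)
      avoids = proj₂ (proj₂ climb)

    same-column-visible : ∀ {k u v} → 1 ≤ k → col u ≡ col v → u ≢ v → Visible k M u v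
    same-column-visible {u = u} {v} 1≤k same u≢v =
      1 , 1≤k , u ∷ (λ _ → v) , edge-isGeodesic u≢v (adj-same-column same u≢v) ,
      edge-interiorAvoids {M}

    isKDistMV-criterion : ∀ {k} → 1 ≤ k →
      (∀ {u v} → M u → M v → ∣ col u - col v ∣ ≤ k) →
      (∀ {u v} → M u → M v → Gaps u v) →
      IsKDistMV G k M
    isKDistMV-criterion 1≤k close gaps u v Mu Mv u≢v with <-cmp (col u) (col v)
    ... | tri< u<v _ _  = ascending-visible u<v (∣m-n∣≤k⇒n≤m+k (close Mu Mv)) (gaps Mu Mv)
    ... | tri≈ _ same _ = same-column-visible 1≤k same u≢v
    ... | tri> _ _ v<u  =
      visible-sym adj-sym {M = M} (ascending-visible v<u (∣m-n∣≤k⇒n≤m+k (close Mv Mu)) (gaps Mv Mu))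

chiCase-suc : ∀ η r → chiCase (suc η) r ≡ 2 + chiCase η r
chiCase-suc η 0                   = *-suc 2 η
chiCase-suc η 1                   = cong (_+ 1) (*-suc 2 η)
chiCase-suc η 2                   = cong (_+ 1) (*-suc 2 η)
chiCase-suc η (suc (suc (suc r))) = cong (_+ 2) (*-suc 2 η)

chiCase-+2 : ∀ η r → chiCase η (2 + r) ≤ 1 + chiCase η r
chiCase-+2 η 0             = ≤-reflexive (+-comm (2 * η) 1)
chiCase-+2 η 1             = ≤-reflexive (trans (+-comm (2 * η) 2) (cong suc (+-comm 1 (2 * η))))
chiCase-+2 η 2             = ≤-reflexive (trans (+-comm (2 * η) 2) (cong suc (+-comm 1 (2 * η))))
chiCase-+2 η (suc (suc (suc r))) = n≤1+n _

chiCase-0≤2 : ∀ r → chiCase 0 r ≤ 2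
chiCase-0≤2 0                   = z≤n
chiCase-0≤2 1                   = s≤s z≤n
chiCase-0≤2 2                   = s≤s z≤n
chiCase-0≤2 (suc (suc (suc r))) = ≤-refl

chiCase-0>0 : ∀ r → 1 ≤ r → 1 ≤ chiCase 0 r
chiCase-0>0 1                   _ = ≤-refl
chiCase-0>0 2                   _ = ≤-refl
chiCase-0>0 (suc (suc (suc r))) _ = s≤s z≤n

chiCase-0≥3 : ∀ r → 3 ≤ r → chiCase 0 r ≡ 2
chiCase-0≥3 (suc (suc (suc r))) _ = refl
chiCase-0≥3 1 (s≤s ())
chiCase-0≥3 2 (s≤s (s≤s ()))

chiCase-≥ : ∀ η r → 2 * η ≤ chiCase η r
chiCase-≥ η 0                   = ≤-refl
chiCase-≥ η 1                   = m≤m+n (2 * η) 1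
chiCase-≥ η 2                   = m≤m+n (2 * η) 1
chiCase-≥ η (suc (suc (suc r))) = m≤m+n (2 * η) 2

module _ {k : ℕ} where

  chiValue-small : ∀ {N} → N < 2 + k → chiValue N k ≡ chiCase 0 N
  chiValue-small N<K = cong₂ chiCase (m<n⇒m/n≡0 N<K) (m<n⇒m%n≡m N<K)

  chiValue-+period : ∀ N → chiValue (N + (2 + k)) k ≡ 2 + chiValue N k
  chiValue-+period N =
    trans (cong₂ chiCase quotient ([m+n]%n≡m%n N (2 + k))) (chiCase-suc (N / (2 + k)) (N % (2 + k)))
    where
    quotient : (N + (2 + k)) / (2 + k) ≡ suc (N / (2 + k))
    quotient = trans (m/n≡1+[m∸n]/n (m≤n+m (2 + k) N)) (cong (λ M → suc (M / (2 + k))) (m+n∸n≡m N (2 + k)))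

  chiValue-+2 : 2 ≤ k → ∀ N → chiValue (2 + N) k ≤ 1 + chiValue N k
  chiValue-+2 2≤k = <-rec _ step
    where
    crossing : ∀ {N} → k ≤ N → N < 2 + k → chiValue (2 + N) k ≤ 1 + chiValue N k
    crossing {N} k≤N N<K rewrite chiValue-small N<K with m≤n⇒m<n∨m≡n k≤N
    ... | inj₂ refl =
      ≤-trans (≤-reflexive (chiValue-+period 0)) (s≤s (chiCase-0>0 k (≤-trans (s≤s z≤n) 2≤k)))
    ... | inj₁ k<N rewrite ≤-antisym (s≤s⁻¹ N<K) k<N =
      ≤-reflexive (trans (chiValue-+period 1) (cong suc (sym (chiCase-0≥3 (suc k) (s≤s 2≤k)))))
    step : ∀ N → (∀ {M} → M < N → chiValue (2 + M) k ≤ 1 + chiValue M k) →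
      chiValue (2 + N) k ≤ 1 + chiValue N k
    step N rec with N <? k | N <? 2 + k
    ... | yes N<k | _
      rewrite chiValue-small {2 + N} (s≤s (s≤s N<k)) | chiValue-small {N} (m≤n⇒m≤1+n (m≤n⇒m≤1+n N<k))
      = chiCase-+2 0 N
    ... | no N≮k | yes N<K = crossing (≮⇒≥ N≮k) N<K
    ... | no _ | no N≮K with m≤n⇒∃[o]o+m≡n (≮⇒≥ N≮K)
    ...   | M , refl rewrite chiValue-+period (2 + M) | chiValue-+period M =
      s≤s (s≤s (rec (m<m+n M (s≤s z≤n))))

  chiValue-least : 2 ≤ k → ∀ n (S : ℕ → ℕ) →
    (∀ {x} → x < n → 1 ≤ S x) →
    (∀ {x} → 2 + x ≤ n → 1 + S (2 + x) ≤ S x ⊎ 2 + S (2 + k + x) ≤ S x) →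
    chiValue n k ≤ S 0
  chiValue-least 2≤k n S S-pos S-step = <-rec P step n (+-identityʳ n)
    where
    P : ℕ → Set
    P N = ∀ {x} → N + x ≡ n → chiValue N k ≤ S x
    step : ∀ N → (∀ {M} → M < N → P M) → P N
    step 0 _ _ = z≤n
    step 1 _ refl = S-pos ≤-refl
    step (suc (suc N)) rec {x} refl with S-step (s≤s (s≤s (m≤n+m x N)))
    ... | inj₁ S-drop₁ = begin
      chiValue (2 + N) k ≤⟨ chiValue-+2 2≤k N ⟩
      1 + chiValue N k   ≤⟨ s≤s (rec (<-trans (n<1+n N) (n<1+n (suc N))) shifted) ⟩
      1 + S (2 + x)      ≤⟨ S-drop₁ ⟩
      S x                ∎
      where
      open ≤-Reasoning
      shifted : N + (2 + x) ≡ 2 + N + x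
      shifted = trans (+-suc N (suc x)) (cong suc (+-suc N x))
    ... | inj₂ S-drop₂ with 2 + N <? 2 + k
    ...   | yes small rewrite chiValue-small small =
      ≤-trans (chiCase-0≤2 (2 + N)) (≤-trans (m≤m+n 2 _) S-drop₂)
    ...   | no large with m≤n⇒∃[o]o+m≡n (≮⇒≥ large)
    ...     | M , eq = begin
      chiValue (2 + N) k       ≡⟨ cong (λ N' → chiValue N' k) eq ⟨
      chiValue (M + (2 + k)) k ≡⟨ chiValue-+period M ⟩
      2 + chiValue M k         ≤⟨ s≤s (s≤s (rec M<2+N (trans (sym (+-assoc M (2 + k) x)) (cong (_+ x) eq)))) ⟩
      2 + S (2 + k + x)        ≤⟨ S-drop₂ ⟩
      S x                      ∎
      where
      open ≤-Reasoning
      M<2+N : M < 2 + N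
      M<2+N = ≤-trans (m<m+n M (s≤s z≤n)) (≤-reflexive eq)

bit : Bool → ℕ
bit false = 0
bit true  = 1

bit≤1 : ∀ b → bit b ≤ 1
bit≤1 false = z≤n
bit≤1 true  = ≤-refl

encode : ℕ → Bool → ℕ
encode t b = 2 * t + bit b

encode-suc : ∀ t b → encode (suc t) b ≡ 2 + encode t b
encode-suc t b = cong (_+ bit b) (*-suc 2 t)

bit≢2+ : ∀ b x → bit b ≢ 2 + x
bit≢2+ false _ ()
bit≢2+ true  _ ()

encode-injective : ∀ {t t' b b'} → encode t b ≡ encode t' b' → t ≡ t' × b ≡ b'
encode-injective {zero}  {zero}  {false} {false} _ = refl , refl
encode-injective {zero}  {zero}  {true}  {true}  _ = refl , refl
encode-injective {zero}  {suc t'} {b} {b'} e = ⊥-elim (bit≢2+ b _ (trans e (encode-suc t' b')))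
encode-injective {suc t} {zero}  {b} {b'} e = ⊥-elim (bit≢2+ b' _ (trans (sym e) (encode-suc t b)))
encode-injective {suc t} {suc t'} {b} {b'} e =
  let e' = trans (sym (encode-suc t b)) (trans e (encode-suc t' b'))
      (t≡t' , b≡b') = encode-injective (+-cancelˡ-≡ 2 _ _ e')
  in cong suc t≡t' , b≡b'

encode-<-before-last : ∀ {t η} r b → t < η → encode t b < chiCase η r
encode-<-before-last {t} {η} r b t<η = begin-strict
  2 * t + bit b ≤⟨ +-monoʳ-≤ (2 * t) (bit≤1 b) ⟩
  2 * t + 1     <⟨ +-monoʳ-< (2 * t) ≤-refl ⟩
  2 * t + 2     ≡⟨ +-comm (2 * t) 2 ⟩
  2 + 2 * t     ≡⟨ *-suc 2 t ⟨
  2 * suc t     ≤⟨ *-monoʳ-≤ 2 t<η ⟩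
  2 * η         ≤⟨ chiCase-≥ η r ⟩
  chiCase η r   ∎
  where open ≤-Reasoning

encode-<-last : ∀ η r b → 1 ≤ r → (r ≤ 2 → b ≡ false) → encode η b < chiCase η r
encode-<-last η 1 b _ short rewrite short (s≤s z≤n) = +-monoʳ-< (2 * η) ≤-refl
encode-<-last η 2 b _ short rewrite short ≤-refl     = +-monoʳ-< (2 * η) ≤-refl
encode-<-last η (suc (suc (suc r))) b _ _ = +-monoʳ-< (2 * η) (s≤s (bit≤1 b))

module Blocks (d : ℕ) .{{_ : NonZero d}} where

  block offset : ℕ → ℕ
  block x  = x / d
  offset x = x % d

  decompose : ∀ x → x ≡ offset x + block x * d
  decompose x = m≡m%n+[m/n]*n x d

  decompose-in : ∀ x {y} → block x ≡ block y → x ≡ offset x + block y * d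
  decompose-in x same = trans (decompose x) (cong (λ t → offset x + t * d) same)

  same-block-∣-∣ : ∀ x y → block x ≡ block y → ∣ x - y ∣ ≡ ∣ offset x - offset y ∣
  same-block-∣-∣ x y same = begin
    ∣ x - y ∣                                           ≡⟨ cong₂ ∣_-_∣ (decompose-in x same) (decompose y) ⟩
    ∣ offset x + block y * d - offset y + block y * d ∣ ≡⟨ cong₂ ∣_-_∣ (+-comm (offset x) _) (+-comm (offset y) _) ⟩
    ∣ block y * d + offset x - block y * d + offset y ∣ ≡⟨ ∣m+n-m+o∣≡∣n-o∣ (block y * d) (offset x) (offset y) ⟩
    ∣ offset x - offset y ∣                             ∎
    where open ≡-Reasoning

  same-block-< : ∀ x y → block x ≡ block y → x < y → offset x < offset y
  same-block-< x y same x<y =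
    +-cancelʳ-< (block y * d) (offset x) (offset y) (subst₂ _<_ (decompose-in x same) (decompose y) x<y)

  block-between : ∀ x y z → block x ≡ block z → x ≤ y → y ≤ z → block y ≡ block x
  block-between x y z same x≤y y≤z =
    ≤-antisym (≤-trans (/-monoˡ-≤ d y≤z) (≤-reflexive (sym same))) (/-monoˡ-≤ d x≤y)

module LowerBound {n m k q : ℕ} (2≤k : 2 ≤ k) (0<m : 0 < m) (c : Fin n × Fin m → Fin q)
  (classes-mv : ∀ i → IsKDistMV (Path n ⊠ Complete m) k (λ x → c x ≡ i)) where

  open PathStrongComplete n m
  open Levels G col col-1-Lipschitz

  vertexAt : ∀ {x} → x < n → V G
  vertexAt x<n = fromℕ< x<n , fromℕ< 0<m

  col-vertexAt : ∀ {x} (x<n : x < n) → col (vertexAt x<n) ≡ x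
  col-vertexAt x<n = toℕ-fromℕ< x<n

  Class : Fin q → V G → Set
  Class i x = c x ≡ i

  colour-visible : ∀ {u v} → c u ≡ c v → u ≢ v → Walks.Visible G k (Class (c v)) u v
  colour-visible {u} {v} cu≡cv = classes-mv (c v) u v cu≡cv refl

  colour-close : ∀ {u v} → c u ≡ c v → ∣ col u - col v ∣ ≤ k
  colour-close {u} {v} cu≡cv with ≡-dec Fin._≟_ Fin._≟_ u v
  ... | yes refl = ≤-trans (≤-reflexive (∣n-n∣≡0 (col u))) z≤n
  ... | no u≢v   = visible-close {M = Class (c v)} (colour-visible cu≡cv u≢v)

  UsedFrom : ℕ → Fin q → Set
  UsedFrom x i = ∃ λ g → x ≤ toℕ g × ∃ λ h → c (g , h) ≡ i

  usedFrom? : ∀ x → Decidable (UsedFrom x)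
  usedFrom? x i = any? λ g → (x ≤? toℕ g) ×-dec any? λ h → c (g , h) Fin.≟ i

  coloursFrom : ℕ → Subset q
  coloursFrom x = subsetOf (usedFrom? x)

  colour∈coloursFrom : ∀ {x} u → x ≤ col u → c u ∈ coloursFrom x
  colour∈coloursFrom (g , h) x≤g = ∈-subsetOf⁺ (usedFrom? _) (g , x≤g , h , refl)

  colour∈coloursFrom-vertexAt : ∀ {x} (x<n : x < n) → c (vertexAt x<n) ∈ coloursFrom x
  colour∈coloursFrom-vertexAt x<n = colour∈coloursFrom (vertexAt x<n) (≤-reflexive (sym (col-vertexAt x<n)))

  coloursFrom-mono : ∀ {x y} → x ≤ y → coloursFrom y ⊆ coloursFrom x
  coloursFrom-mono x≤y i∈ =
    let (g , y≤g , h , e) = ∈-subsetOf⁻ (usedFrom? _) i∈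
    in ∈-subsetOf⁺ (usedFrom? _) (g , ≤-trans x≤y y≤g , h , e)

  coloursFrom-nonempty : ∀ {x} → x < n → 1 ≤ ∣ coloursFrom x ∣
  coloursFrom-nonempty x<n = ≤-trans (s≤s z≤n) (x∈p⇒∣p-x∣<∣p∣ (colour∈coloursFrom-vertexAt x<n))

  colour∉coloursFrom-far : ∀ {x} u → col u ≤ suc x → c u ∉ coloursFrom (2 + k + x)
  colour∉coloursFrom-far {x} u u≤1+x cu∈ =
    let (g , far , h , e) = ∈-subsetOf⁻ (usedFrom? _) cu∈ in
    <⇒≱ (≤-trans (s≤s (+-monoˡ-≤ k u≤1+x)) (≤-trans (≤-reflexive (cong (suc ∘ suc) (+-comm x k))) far))
         (∣m-n∣≤k⇒n≤m+k (colour-close (sym e)))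

  -- a geodesic from column x to a column beyond x + 1 has an interior vertex in column x + 1
  colour∉coloursFrom-blocked : ∀ {x} u (x+1<n : suc x < n) → col u ≡ x →
    (∀ h → c (fromℕ< x+1<n , h) ≡ c u) → c u ∉ coloursFrom (2 + x)
  colour∉coloursFrom-blocked {x} u x+1<n u≡x column-full cu∈ =
    cz≢cv (trans (column-full' z≡x+1) (sym cv≡cu))
    where
    used = ∈-subsetOf⁻ (usedFrom? _) cu∈
    v : V G
    v = proj₁ used , proj₁ (proj₂ (proj₂ used))
    2+x≤v : 2 + x ≤ col v
    2+x≤v = proj₁ (proj₂ used)
    cv≡cu : c v ≡ c u
    cv≡cu = proj₂ (proj₂ (proj₂ used))
    u≢v : u ≢ v
    u≢v u≡v = <⇒≢ (≤-trans (s≤s (n≤1+n x)) 2+x≤v) (trans (sym u≡x) (cong col u≡v))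
    crossing = visible-crosses {M = Class (c v)} (colour-visible (sym cv≡cu) u≢v)
                               (≤-reflexive (cong suc u≡x)) 2+x≤v
    z = proj₁ crossing
    z≡x+1 = proj₁ (proj₂ crossing)
    cz≢cv = proj₂ (proj₂ crossing)
    column-full' : col z ≡ suc x → c z ≡ c u
    column-full' e =
      subst (λ g → c (g , proj₂ z) ≡ c u) (toℕ-injective (trans (toℕ-fromℕ< x+1<n) (sym e)))
            (column-full (proj₂ z))

  module _ {x} (2+x≤n : 2 + x ≤ n) where

    private
      x<n : x < n
      x<n = ≤-trans (n≤1+n (suc x)) 2+x≤n
      u : V G
      u = vertexAt x<n
      g₁ : Fin n
      g₁ = fromℕ< 2+x≤n

    coloursFrom-drop : 1 + ∣ coloursFrom (2 + x) ∣ ≤ ∣ coloursFrom x ∣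
                     ⊎ 2 + ∣ coloursFrom (2 + k + x) ∣ ≤ ∣ coloursFrom x ∣
    coloursFrom-drop with all? (λ h → c (g₁ , h) Fin.≟ c u)
    ... | yes full =
      inj₁ (p⊂q⇒∣p∣<∣q∣ ( coloursFrom-mono (m≤n+m x 2) , c u , colour∈coloursFrom-vertexAt x<n
                        , colour∉coloursFrom-blocked u 2+x≤n (col-vertexAt x<n) full))
    ... | no ¬full =
      inj₂ (2+∣p∣≤∣q∣ (coloursFrom-mono (m≤n+m x (2 + k)))
                      (colour∈coloursFrom-vertexAt x<n)
                      (colour∈coloursFrom u₁ (≤-trans (n≤1+n x) (≤-reflexive (sym (toℕ-fromℕ< 2+x≤n)))))
                      (cu₁≢cu ∘ sym)
                      (colour∉coloursFrom-far u (≤-trans (≤-reflexive (col-vertexAt x<n)) (n≤1+n x)))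
                      (colour∉coloursFrom-far u₁ (≤-reflexive (toℕ-fromℕ< 2+x≤n))))
      where
      witness = ¬∀⟶∃¬ m _ (λ h → c (g₁ , h) Fin.≟ c u) ¬full
      u₁ : V G
      u₁ = g₁ , proj₁ witness
      cu₁≢cu : c u₁ ≢ c u
      cu₁≢cu = proj₂ witness

  lower-bound : chiValue n k ≤ q
  lower-bound = begin
    chiValue n k           ≤⟨ chiValue-least 2≤k n (∣_∣ ∘ coloursFrom) coloursFrom-nonempty coloursFrom-drop ⟩
    ∣ coloursFrom 0 ∣       ≤⟨ ∣p∣≤n (coloursFrom 0) ⟩
    q                      ∎
    where open ≤-Reasoning

module UpperBound {n m k : ℕ} (2≤k : 2 ≤ k) (2≤m : 2 ≤ m) where

  open PathStrongComplete n m
  open Blocks (2 + k)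

  Upper : ℕ → ℕ → Set
  Upper x y = offset x ≡ suc k ⊎ (1 ≤ offset x × offset x < k × 1 ≤ y × suc x < n)

  -- opaque, so that `side` below does not unfold into a boolean formula and can be
  -- analysed by `with upper? x y`
  opaque
    upper? : ∀ x y → Dec (Upper x y)
    upper? x y =
      (offset x ≟ suc k) ⊎-dec ((1 ≤? offset x) ×-dec ((offset x <? k) ×-dec ((1 ≤? y) ×-dec (suc x <? n))))

  side : V G → Bool
  side (g , h) = does (upper? (toℕ g) (toℕ h))

  colourℕ : V G → ℕ
  colourℕ u = encode (block (col u)) (side u)

  side-window : ∀ u → bit (side u) ≤ offset (col u) × offset (col u) ≤ bit (side u) + k
  side-window (g , h) with upper? (toℕ g) (toℕ h)
  ... | yes (inj₁ o≡1+k)     = ≤-trans (s≤s z≤n) (≤-reflexive (sym o≡1+k)) , o≤1+k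
    where o≤1+k = s≤s⁻¹ (m%n<n (toℕ g) (2 + k))
  ... | yes (inj₂ (1≤o , _)) = 1≤o , s≤s⁻¹ (m%n<n (toℕ g) (2 + k))
  ... | no ¬upper            = z≤n , s≤s⁻¹ (≤∧≢⇒< (s≤s⁻¹ (m%n<n (toℕ g) (2 + k))) (¬upper ∘ inj₁))

  colourℕ-injective : ∀ {u v} → colourℕ u ≡ colourℕ v →
    block (col u) ≡ block (col v) × side u ≡ side v
  colourℕ-injective {u} {v} = encode-injective {block (col u)} {block (col v)} {side u} {side v}

  colourℕ-close : ∀ {u v} → colourℕ u ≡ colourℕ v → ∣ col u - col v ∣ ≤ k
  colourℕ-close {u} {v} same-colour =
    ≤-trans (≤-reflexive (same-block-∣-∣ (col u) (col v) (proj₁ same)))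
            (offsets-close (≤-total (offset (col u)) (offset (col v))))
    where
    same = colourℕ-injective {u} {v} same-colour
    u-window = side-window u
    v-window = subst (λ s → bit s ≤ offset (col v) × offset (col v) ≤ bit s + k)
                     (sym (proj₂ same)) (side-window v)
    offsets-close : offset (col u) ≤ offset (col v) ⊎ offset (col v) ≤ offset (col u) →
                    ∣ offset (col u) - offset (col v) ∣ ≤ k
    offsets-close (inj₁ u≤v) = ∣m-n∣≤k-window (proj₁ u-window) (proj₂ v-window) u≤v
    offsets-close (inj₂ v≤u) =
      subst (_≤ k) (∣-∣-comm (offset (col v)) _) (∣m-n∣≤k-window (proj₁ v-window) (proj₂ u-window) v≤u)

  colourℕ-gap : ∀ {u v} → colourℕ u ≡ colourℕ v →
    ∀ g → col u < toℕ g → toℕ g < col v → ∃ λ h → colourℕ (g , h) ≢ colourℕ u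
  colourℕ-gap {u} {v} same-colour g u<g g<v = row-of-other-side (side u) refl
    where
    same = colourℕ-injective {u} {v} same-colour
    g-block : block (toℕ g) ≡ block (col u)
    g-block = block-between (col u) (toℕ g) (col v) (proj₁ same) (<⇒≤ u<g) (<⇒≤ g<v)
    u<g-offset : offset (col u) < offset (toℕ g)
    u<g-offset = same-block-< (col u) (toℕ g) (sym g-block) u<g
    g<v-offset : offset (toℕ g) < offset (col v)
    g<v-offset = same-block-< (toℕ g) (col v) (trans g-block (proj₁ same)) g<v
    v≤side+k : ∀ {s} → side u ≡ s → offset (col v) ≤ bit s + k
    v≤side+k side-u = subst (λ s → offset (col v) ≤ bit s + k) (trans (sym (proj₂ same)) side-u)
                            (proj₂ (side-window v))
    other-side : ∀ h → side (g , h) ≢ side u → colourℕ (g , h) ≢ colourℕ u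
    other-side h differ = differ ∘ proj₂ ∘ colourℕ-injective {g , h} {u}
    row₀ row₁ : Fin m
    row₀ = fromℕ< (≤-trans (s≤s z≤n) 2≤m)
    row₁ = fromℕ< 2≤m
    row-of-other-side : ∀ s → side u ≡ s → ∃ λ h → colourℕ (g , h) ≢ colourℕ u
    row-of-other-side true side-u =
      row₀ , other-side row₀ (λ e → case trans (sym side-g₀) (trans e side-u) of λ ())
      where
      ¬upper : ¬ Upper (toℕ g) (toℕ row₀)
      ¬upper (inj₁ g≡1+k)                = <⇒≢ (<-≤-trans g<v-offset (v≤side+k side-u)) g≡1+k
      ¬upper (inj₂ (_ , _ , 1≤row₀ , _)) = <⇒≢ 1≤row₀ (sym (toℕ-fromℕ< _))
      side-g₀ : side (g , row₀) ≡ false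
      side-g₀ = dec-false (upper? _ _) ¬upper
    row-of-other-side false side-u =
      row₁ , other-side row₁ (λ e → case trans (sym side-g₁) (trans e side-u) of λ ())
      where
      upper : Upper (toℕ g) (toℕ row₁)
      upper = inj₂ ( ≤-trans (s≤s z≤n) u<g-offset
                   , <-≤-trans g<v-offset (v≤side+k side-u)
                   , ≤-reflexive (sym (toℕ-fromℕ< 2≤m))
                   , ≤-trans (s≤s g<v) (toℕ<n (proj₁ v)) )
      side-g₁ : side (g , row₁) ≡ true
      side-g₁ = dec-true (upper? _ _) upper

  colourℕ<chiValue : ∀ u → colourℕ u < chiValue n k
  colourℕ<chiValue u@(g , _) with m≤n⇒m<n∨m≡n (/-monoˡ-≤ (2 + k) (<⇒≤ (toℕ<n g)))
  ... | inj₁ before = encode-<-before-last (offset n) (side u) before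
  ... | inj₂ last   =
    subst (λ t → encode t (side u) < chiValue n k) (sym last)
          (encode-<-last (block n) (offset n) (side u) 1≤r short)
    where
    x = toℕ g
    x<r-offset : offset x < offset n
    x<r-offset = same-block-< x n last (toℕ<n g)
    1≤r : 1 ≤ offset n
    1≤r = ≤-trans (s≤s z≤n) x<r-offset
    short : offset n ≤ 2 → side u ≡ false
    short r≤2 = dec-false (upper? _ _) ¬upper
      where
      ¬upper : ¬ Upper x _
      ¬upper (inj₁ x≡1+k) = <⇒≢ (<-≤-trans x<r-offset (≤-trans r≤2 (m≤n⇒m≤1+n 2≤k))) x≡1+k
      ¬upper (inj₂ (1≤x , _ , _ , x+1<n)) = <⇒≱ (≤-<-trans (≤-trans (s≤s 1≤x) x<x+1) x+1<r) r≤2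
        where
        next-block : block (suc x) ≡ block x
        next-block = block-between x (suc x) n last (n≤1+n x) (<⇒≤ x+1<n)
        x<x+1 : offset x < offset (suc x)
        x<x+1 = same-block-< x (suc x) (sym next-block) (n<1+n x)
        x+1<r : offset (suc x) < offset n
        x+1<r = same-block-< (suc x) n (trans next-block last) x+1<n

  colouring : V G → Fin (chiValue n k)
  colouring u = fromℕ< (colourℕ<chiValue u)

  colouring-classes : ∀ i → IsKDistMV G k (λ x → colouring x ≡ i)
  colouring-classes i = isKDistMV-criterion (≤-trans (s≤s z≤n) 2≤k) close gaps
    where
    same-colourℕ : ∀ {u v} → colouring u ≡ i → colouring v ≡ i → colourℕ u ≡ colourℕ v
    same-colourℕ {u} {v} cu≡i cv≡i =
      trans (sym (toℕ-fromℕ< (colourℕ<chiValue u)))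
            (trans (cong toℕ (trans cu≡i (sym cv≡i))) (toℕ-fromℕ< (colourℕ<chiValue v)))
    close : ∀ {u v} → colouring u ≡ i → colouring v ≡ i → ∣ col u - col v ∣ ≤ k
    close cu≡i cv≡i = colourℕ-close (same-colourℕ cu≡i cv≡i)
    gaps : ∀ {u v} → colouring u ≡ i → colouring v ≡ i →
      ∀ g → col u < toℕ g → toℕ g < col v → ∃ λ h → colouring (g , h) ≢ i
    gaps cu≡i cv≡i g u<g g<v =
      let (h , differ) = colourℕ-gap (same-colourℕ cu≡i cv≡i) g u<g g<v
      in h , λ cgh≡i → differ (same-colourℕ cgh≡i cu≡i)

  upper-bound : KDistMVColouring G k (chiValue n k)
  upper-bound = colouring , colouring-classes

proposition5p1 : ∀ (n m k : ℕ) → 4 ≤ n → 2 ≤ m → 2 ≤ k → k ≤ n ∸ 2 →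
    ChiMuK≡ (Path n ⊠ Complete m) k (chiValue n k)
proposition5p1 n m k _ 2≤m 2≤k _ =
  UpperBound.upper-bound {n} {m} 2≤k 2≤m ,
  λ q q<χ (c , classes) → <⇒≱ q<χ (LowerBound.lower-bound 2≤k (≤-trans (s≤s z≤n) 2≤m) c classes)
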